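{- Let $G$ be a deductive filter of a square-increasing IRL $\mathbf{A}$. Then $\mathbf{A}/G$ is idempotent if and only if $\neg(f^2)\in G$. In particular, $\mathbf{A}/[\neg(f^2))$ is idempotent, where $[\neg(f^2))=\{x\in A:\neg(f^2)\leqslant x\}$.
   Context: An involutive (commutative) residuated lattice (IRL) is an algebra $\langle A;\cdot,\wedge,\vee,\neg,e\rangle$ such that $\langle A;\cdot,e\rangle$ is a commutative monoid, $\langle A;\wedge,\vee\rangle$ is a lattice with order $\leqslant$, $\neg\neg x=x$, and $x\cdot y\leqslant z\iff \neg z\cdot y\leqslant\neg x$. Write $f:=\neg e$, $x\to y:=\neg(x\cdot\neg y)$, $x^2:=x\cdot x$. It is square-increasing if $x\leqslant x^2$, idempotent if $x^2=x$, for all $x$. A deductive filter of $\mathbf{A}$ is a lattice filter of $\langle A;\wedge,\vee\rangle$ that is also a submonoid of $\langle A;\cdot,e\rangle$ (in the square-increasing case, these are exactly the lattice filters containing $e$, so $[\neg(f^2))$ is one). $\mathbf{A}/G$ is the quotient of $\mathbf{A}$ by the congruence $\{\langle a,b\rangle: a\to b\in G\text{ and } b\to a\in G\}$. -}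

module Defs where

open import Level using (Level; _⊔_; suc)
open import Data.Product using (_×_; _,_)
open import Relation.Binary.PropositionalEquality using (_≡_)
open import Algebra.Structures using (IsCommutativeMonoid)
open import Algebra.Lattice.Structures using (IsLattice)
open import Function.Bundles using (_⇔_)

record IRL (a : Level) : Set (suc a) where
  infixl 7 _·_
  infixr 6 _∧_
  infixr 5 _∨_
  infix 4 _≤_
  field
    Carrier : Set a
    _·_ : Carrier → Carrier → Carrier
    _∧_ : Carrier → Carrier → Carrier
    _∨_ : Carrier → Carrier → Carrier
    ¬_  : Carrier → Carrier
    e   : Carrier
    ·-isCommutativeMonoid : IsCommutativeMonoid _≡_ _·_ e
    isLattice : IsLattice _≡_ _∨_ _∧_

  _≤_ : Carrier → Carrier → Set a
  x ≤ y = x ∧ y ≡ x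

  field
    ¬¬-involutive : ∀ x → ¬ (¬ x) ≡ x
    residuation   : ∀ x y z → (x · y ≤ z) ⇔ (¬ z · y ≤ ¬ x)

  f : Carrier
  f = ¬ e

  _⇒_ : Carrier → Carrier → Carrier
  x ⇒ y = ¬ (x · ¬ y)

  _² : Carrier → Carrier
  x ² = x · x

open IRL public

SquareIncreasing : ∀ {a} → IRL a → Set a
SquareIncreasing A = ∀ x → _≤_ A x (_² A x)

Idempotent : ∀ {a} → IRL a → Set a
Idempotent A = ∀ x → _² A x ≡ x

record IsDeductiveFilter {a ℓ} (A : IRL a) (G : Carrier A → Set ℓ) : Set (a ⊔ ℓ) where
  field
    up-closed : ∀ {x y} → G x → _≤_ A x y → G y
    ∧-closed  : ∀ {x y} → G x → G y → G (_∧_ A x y)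
    e∈        : G (e A)
    ·-closed  : ∀ {x y} → G x → G y → G (_·_ A x y)

-- The congruence θ_G = {⟨a,b⟩ : a → b ∈ G and b → a ∈ G}; A/G is A modulo θ_G.
θ : ∀ {a ℓ} (A : IRL a) (G : Carrier A → Set ℓ) → Carrier A → Carrier A → Set ℓ
θ A G x y = G (_⇒_ A x y) × G (_⇒_ A y x)

-- A/G is idempotent: [x]·[x] = [x] in A/G for every x, i.e. x² θ_G x.
QuotientIdempotent : ∀ {a ℓ} (A : IRL a) (G : Carrier A → Set ℓ) → Set (a ⊔ ℓ)
QuotientIdempotent A G = ∀ x → θ A G (_² A x) x

↑ : ∀ {a} (A : IRL a) → Carrier A → Carrier A → Set a
↑ A c x = _≤_ A c x

-- Write c = ¬(f²).  In A/G the class of x² equals that of x exactly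
-- when x² ⇒ x ∈ G and x ⇒ x² ∈ G.  The second always holds, because
-- square-increase gives e ≤ x ⇒ x².  For the first, squaring x · ¬x ≤ f
-- and using ¬x ≤ (¬x)² gives x² · ¬x ≤ f², i.e. c ≤ x² ⇒ x by residuation;
-- so c ∈ G suffices.
-- Conversely, the instance x = f reads f² ⇒ f = c ∈ G.
module Submission where

open import Defs
  using (IRL; SquareIncreasing; IsDeductiveFilter; QuotientIdempotent; ↑)
open import Level using (Level)
open import Data.Product using (_×_; _,_; proj₁)
open import Function.Bundles using (_⇔_; mk⇔; Equivalence)
open import Relation.Binary.PropositionalEquality
  using (_≡_; refl; sym; trans; cong; subst; module ≡-Reasoning)
open import Algebra.Structures using (IsCommutativeMonoid)
open import Algebra.Lattice.Structures using (IsLattice)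

module Order {a : Level} (A : IRL a) where
  open IRL A
  open IsCommutativeMonoid ·-isCommutativeMonoid
    using (comm; identityˡ; identityʳ)
  open IsLattice isLattice using (∧-assoc; ∧-absorbs-∨; ∨-absorbs-∧)

  ≤-refl : ∀ x → x ≤ x
  ≤-refl x = trans (cong (x ∧_) (sym (∨-absorbs-∧ x x))) (∧-absorbs-∨ x (x ∧ x))

  ≤-trans : ∀ {x y z} → x ≤ y → y ≤ z → x ≤ z
  ≤-trans {x} {y} {z} x≤y y≤z = begin
    x ∧ z         ≡⟨ cong (_∧ z) (sym x≤y) ⟩
    (x ∧ y) ∧ z   ≡⟨ ∧-assoc x y z ⟩
    x ∧ (y ∧ z)   ≡⟨ cong (x ∧_) y≤z ⟩
    x ∧ y         ≡⟨ x≤y ⟩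
    x             ∎
    where open ≡-Reasoning

  ≤-respʳ : ∀ {x y z} → x ≤ y → y ≡ z → x ≤ z
  ≤-respʳ x≤y refl = x≤y

  ≤-respˡ : ∀ {x y z} → x ≡ y → y ≤ z → x ≤ z
  ≤-respˡ refl y≤z = y≤z

  ≤-∧ : ∀ {c x y} → c ≤ x → c ≤ y → c ≤ x ∧ y
  ≤-∧ {c} {x} {y} c≤x c≤y =
    trans (sym (∧-assoc c x y)) (trans (cong (_∧ y) c≤x) c≤y)

  residuate : ∀ {x y z} → x · y ≤ z → ¬ z · y ≤ ¬ x
  residuate {x} {y} {z} = Equivalence.to (residuation x y z)

  unresiduate : ∀ {x y z} → ¬ z · y ≤ ¬ x → x · y ≤ z
  unresiduate {x} {y} {z} = Equivalence.from (residuation x y z)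

  ¬-antitone : ∀ {x z} → x ≤ z → ¬ z ≤ ¬ x
  ¬-antitone {x} {z} x≤z =
    ≤-respˡ (sym (identityʳ (¬ z))) (residuate (≤-respˡ (identityʳ x) x≤z))

  ¬-reflects : ∀ {x z} → ¬ z ≤ ¬ x → x ≤ z
  ¬-reflects {x} {z} ¬z≤¬x =
    ≤-respˡ (sym (identityʳ x)) (unresiduate (≤-respˡ (identityʳ (¬ z)) ¬z≤¬x))

  ·-monoˡ : ∀ {x y z} → x ≤ y → x · z ≤ y · z
  ·-monoˡ {x} {y} {z} x≤y =
    unresiduate (≤-trans (residuate (≤-refl (y · z))) (¬-antitone x≤y))

  ·-monoʳ : ∀ {x y z} → x ≤ y → z · x ≤ z · y
  ·-monoʳ {x} {y} {z} x≤y = ≤-respˡ (comm z x) (≤-respʳ (·-monoˡ x≤y) (comm y z))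

  ·-mono : ∀ {x y u v} → x ≤ y → u ≤ v → x · u ≤ y · v
  ·-mono x≤y u≤v = ≤-trans (·-monoˡ x≤y) (·-monoʳ u≤v)

  ⇒-intro : ∀ {x y z} → x · y ≤ z → y ≤ x ⇒ z
  ⇒-intro {x} {y} {z} xy≤z =
    ≤-respˡ (sym (¬¬-involutive y))
      (¬-antitone (≤-respˡ (cong (_· ¬ z) (sym (¬¬-involutive x)))
        (residuate (≤-respˡ (comm y (¬ z)) (residuate xy≤z)))))

  contradiction≤f : ∀ x → x · ¬ x ≤ f
  contradiction≤f x =
    unresiduate (≤-respˡ (cong (_· ¬ x) (¬¬-involutive e))
                  (≤-respˡ (identityˡ (¬ x)) (≤-refl (¬ x))))

module SquareIncreasingFacts {a : Level} (A : IRL a) (si : SquareIncreasing A) where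
  open IRL A
  open Order A
  open IsCommutativeMonoid ·-isCommutativeMonoid using (comm; assoc; identityʳ)
  open ≡-Reasoning

  c : Carrier
  c = ¬ (f ²)

  square-interchange : ∀ x y → x ² · y ² ≡ (x · y) ²
  square-interchange x y = begin
    (x · x) · (y · y)   ≡⟨ assoc x x (y · y) ⟩
    x · (x · (y · y))   ≡⟨ cong (x ·_) (sym (assoc x y y)) ⟩
    x · ((x · y) · y)   ≡⟨ cong (λ t → x · (t · y)) (comm x y) ⟩
    x · ((y · x) · y)   ≡⟨ cong (x ·_) (assoc y x y) ⟩
    x · (y · (x · y))   ≡⟨ sym (assoc x y (x · y)) ⟩
    (x · y) · (x · y)   ∎

  -- Squaring the law of contradiction, using ¬x ≤ (¬x)².
  square-contradiction : ∀ x → x ² · ¬ x ≤ f ²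
  square-contradiction x =
    ≤-trans (·-monoʳ (si (¬ x)))
      (≤-respˡ (square-interchange x (¬ x))
        (·-mono (contradiction≤f x) (contradiction≤f x)))

  c≤square⇒ : ∀ x → c ≤ (x ²) ⇒ x
  c≤square⇒ x = ¬-antitone (square-contradiction x)

  e≤⇒square : ∀ x → e ≤ x ⇒ (x ²)
  e≤⇒square x = ⇒-intro (≤-respˡ (identityʳ x) (si x))

  square-f⇒f : (f ²) ⇒ f ≡ c
  square-f⇒f = cong ¬_ (trans (cong (f ² ·_) (¬¬-involutive e)) (identityʳ (f ²)))

  c≤e : c ≤ e
  c≤e = ¬-reflects (≤-respʳ (si f) (sym (¬¬-involutive (f ²))))

  idempotent⇒c∈ : ∀ {ℓ} (G : Carrier → Set ℓ) → QuotientIdempotent A G → G c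
  idempotent⇒c∈ G idem = subst G square-f⇒f (proj₁ (idem f))

  c∈⇒idempotent : ∀ {ℓ} (G : Carrier → Set ℓ) →
    (∀ {x y} → G x → x ≤ y → G y) → G e → G c → QuotientIdempotent A G
  c∈⇒idempotent G up-closed e∈G c∈G x =
    up-closed c∈G (c≤square⇒ x) , up-closed e∈G (e≤⇒square x)

  idempotent⇔c∈ : ∀ {ℓ} (G : Carrier → Set ℓ) → IsDeductiveFilter A G →
    QuotientIdempotent A G ⇔ G c
  idempotent⇔c∈ G filter = mk⇔ (idempotent⇒c∈ G)
    (c∈⇒idempotent G (IsDeductiveFilter.up-closed filter) (IsDeductiveFilter.e∈ filter))

  ↑c-deductive : IsDeductiveFilter A (↑ A c)
  ↑c-deductive = record
    { up-closed = ≤-trans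
    ; ∧-closed  = ≤-∧
    ; e∈        = c≤e
    ; ·-closed  = λ c≤x c≤y → ≤-trans (si c) (·-mono c≤x c≤y)
    }

open import Defs using (Carrier; ¬_; _²; f)

theorem3p5 : ∀ {a ℓ : Level} (A : IRL a) → SquareIncreasing A →
    ((G : Carrier A → Set ℓ) → IsDeductiveFilter A G →
    (QuotientIdempotent A G ⇔ G (¬_ A (_² A (f A)))))
    × QuotientIdempotent A (↑ A (¬_ A (_² A (f A))))
theorem3p5 A si =
  idempotent⇔c∈ , Equivalence.from (idempotent⇔c∈ (↑ A c) ↑c-deductive) c∈↑c
  where
  open SquareIncreasingFacts A si using (c; idempotent⇔c∈; ↑c-deductive)

  c∈↑c : ↑ A c c
  c∈↑c = Order.≤-refl A c
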